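{- Let $P,Q$ be distributions on $[n]=\{1,\dots,n\}$ and let $\varepsilon_1\in(0,1)$. Suppose $\ell_\infty(P,Q)\le\varepsilon_1$, i.e. $(1-\varepsilon_1)Q(x)\le P(x)\le(1+\varepsilon_1)Q(x)$ for all $x\in[n]$. Then for every $x\in[n]$ with $P(x)>0$ and $Q(x)>0$, $\mathrm{tilt}_P(x)=O(\mathrm{tilt}_Q(x))$, where the implied constant depends only on $\varepsilon_1$.
   Context: For a distribution $P$ on $[n]$ and $x$ with $P(x)>0$, $\mathrm{tilt}_P(x)=\max\{\max_{y<x}\frac{P(y)}{P([y+1,x])},\ \max_{y>x}\frac{P(y)}{P([x,y-1])}\}$, where $[a,b]=\{a,\dots,b\}$ and $P([a,b])=\sum_{t=a}^bP(t)$.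
   Formalization: The distributions P and Q take rational values, and the parameter ε₁ is a rational number in (0,1). -}

module Defs where

open import Data.Nat as ℕ using (ℕ; _∸_)
import Data.Nat.Properties as ℕP
open import Data.Fin using (Fin; toℕ)
open import Data.List using (List; foldr; map; filter; allFin)
open import Data.Rational using (ℚ; 0ℚ; 1ℚ; _+_; _÷_; _⊔_; _≤_; ≢-nonZero)
open import Data.Rational.Properties using (_≟_)
open import Relation.Nullary using (yes; no)
open import Relation.Nullary.Decidable using (_×-dec_)
open import Data.Product using (_×_)

sumℚ : List ℚ → ℚ
sumℚ = foldr _+_ 0ℚ

-- Division with the (irrelevant here) convention p / 0 = 0.
-- In the theorem every denominator used is strictly positive.
_/'_ : ℚ → ℚ → ℚ
p /' q with q ≟ 0ℚ
... | yes _ = 0ℚ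
... | no q≢0 = _÷_ p q {{≢-nonZero q≢0}}

-- A distribution on [n], the points being Fin n (0-based; the order on
-- Fin n is the order on [n] shifted by one).
IsDistribution : ∀ {n} → (Fin n → ℚ) → Set
IsDistribution {n} P = (∀ x → 0ℚ ≤ P x) × (sumℚ (map P (allFin n)) ≡ 1ℚ)
  where open import Relation.Binary.PropositionalEquality using (_≡_)

mass : ∀ {n} → (Fin n → ℚ) → ℕ → ℕ → ℚ
mass {n} P a b =
  sumℚ (map P (filter (λ t → (a ℕP.≤? toℕ t) ×-dec (toℕ t ℕP.≤? b)) (allFin n)))

-- The ratio attached to y in the definition of tilt_P(x):
--   y < x : P(y) / P([y+1, x]);   y > x : P(y) / P([x, y-1]);   y = x : 0.
tiltTerm : ∀ {n} → (Fin n → ℚ) → Fin n → Fin n → ℚ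
tiltTerm P x y with toℕ y ℕP.<? toℕ x
... | yes _ = P y /' mass P (ℕ.suc (toℕ y)) (toℕ x)
... | no _ with toℕ x ℕP.<? toℕ y
...   | yes _ = P y /' mass P (toℕ x) (toℕ y ∸ 1)
...   | no _ = 0ℚ

-- tilt_P(x): maximum of the above ratios over all y ≠ x (all ratios are
-- nonnegative, so folding with ⊔ from 0 gives that maximum; an empty
-- maximum is 0).
tilt : ∀ {n} → (Fin n → ℚ) → Fin n → ℚ
tilt {n} P x = foldr _⊔_ 0ℚ (map (tiltTerm P x) (allFin n))

{-# OPTIONS --safe #-}

-- Each ratio defining tilt_P(x) has numerator P(y) ≤ (1+ε)Q(y) and
-- denominator P(I) ≥ (1−ε)Q(I), where the interval I contains x and so has
-- positive Q-mass; hence every ratio, and with it their maximum, is at most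
-- (1+ε)/(1−ε) times its counterpart for Q.
module Submission where

open import Defs
open import Data.Nat using (ℕ)
open import Data.Fin using (Fin)
open import Data.Product using (_×_; ∃-syntax)
open import Data.Rational using (ℚ; 0ℚ; 1ℚ; _+_; _-_; _*_; _≤_; _<_)

open import Data.Empty using (⊥-elim)
open import Data.Fin using (toℕ)
open import Data.List using ([]; _∷_; foldr; map; filter; allFin)
open import Data.List.Membership.Propositional using (_∈_)
open import Data.List.Membership.Propositional.Properties using (∈-allFin; ∈-filter⁺)
open import Data.List.Relation.Unary.Any using (here; there)
import Data.Nat as ℕ
import Data.Nat.Properties as ℕ
open import Data.Product using (_,_; proj₁; proj₂)
open import Data.Rational using (_÷_; 1/_; _⊔_; -_; NonZero; Positive; NonNegative; positive; nonNegative)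
open import Data.Rational.Properties
open import Data.Rational.Solver using (module +-*-Solver)
open import Function using (_∘_)
open import Relation.Binary.PropositionalEquality using (_≡_; refl; sym; cong; cong₂; subst)
open import Relation.Nullary using (Dec; yes; no)
open import Relation.Nullary.Decidable using (_×-dec_)

module _ {A : Set} (f : A → ℚ) (f≥0 : ∀ a → 0ℚ ≤ f a) where

  sumℚ-nonNeg : ∀ xs → 0ℚ ≤ sumℚ (map f xs)
  sumℚ-nonNeg []       = ≤-refl
  sumℚ-nonNeg (a ∷ xs) = +-mono-≤ (f≥0 a) (sumℚ-nonNeg xs)

  ∈⇒≤sumℚ : ∀ {i xs} → i ∈ xs → f i ≤ sumℚ (map f xs)
  ∈⇒≤sumℚ {i} {_ ∷ xs} (here refl) =
    subst (_≤ f i + sumℚ (map f xs)) (+-identityʳ (f i)) (+-monoʳ-≤ (f i) (sumℚ-nonNeg xs))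
  ∈⇒≤sumℚ {i} {a ∷ xs} (there i∈xs) =
    subst (_≤ f a + sumℚ (map f xs)) (+-identityˡ (f i)) (+-mono-≤ (f≥0 a) (∈⇒≤sumℚ i∈xs))

module _ {A : Set} (c : ℚ) {f g : A → ℚ} where

  *-sumℚ-≤ : (∀ a → c * g a ≤ f a) → ∀ xs → c * sumℚ (map g xs) ≤ sumℚ (map f xs)
  *-sumℚ-≤ cg≤f []       = ≤-reflexive (*-zeroʳ c)
  *-sumℚ-≤ cg≤f (a ∷ xs) =
    ≤-trans (≤-reflexive (*-distribˡ-+ c (g a) _)) (+-mono-≤ (cg≤f a) (*-sumℚ-≤ cg≤f xs))

  max-≤-*max : .{{_ : NonNegative c}} → (∀ a → f a ≤ c * g a) →
               ∀ xs → foldr _⊔_ 0ℚ (map f xs) ≤ c * foldr _⊔_ 0ℚ (map g xs)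
  max-≤-*max f≤cg []       = ≤-reflexive (sym (*-zeroʳ c))
  max-≤-*max f≤cg (a ∷ xs) = ⊔-lub
    (≤-trans (f≤cg a) (*-monoˡ-≤-nonNeg c (p≤p⊔q (g a) _)))
    (≤-trans (max-≤-*max f≤cg xs) (*-monoˡ-≤-nonNeg c (p≤q⊔p (g a) _)))

∈[_,_]? : ∀ {n} (lo hi : ℕ) (t : Fin n) → Dec ((lo ℕ.≤ toℕ t) × (toℕ t ℕ.≤ hi))
∈[ lo , hi ]? t = (lo ℕ.≤? toℕ t) ×-dec (toℕ t ℕ.≤? hi)

mass-pos : ∀ {n} {Q : Fin n → ℚ} → (∀ t → 0ℚ ≤ Q t) → ∀ {x} → 0ℚ < Q x →
           ∀ {lo hi} → lo ℕ.≤ toℕ x → toℕ x ℕ.≤ hi → 0ℚ < mass Q lo hi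
mass-pos {Q = Q} Q≥0 {x} Qx>0 {lo} {hi} lo≤x x≤hi =
  <-≤-trans Qx>0 (∈⇒≤sumℚ Q Q≥0 (∈-filter⁺ ∈[ lo , hi ]? (∈-allFin x) (lo≤x , x≤hi)))

*-mass-≤ : ∀ {n} c {P Q : Fin n → ℚ} → (∀ t → c * Q t ≤ P t) → ∀ lo hi → c * mass Q lo hi ≤ mass P lo hi
*-mass-≤ c cQ≤P lo hi = *-sumℚ-≤ c cQ≤P (filter ∈[ lo , hi ]? (allFin _))

p<q⇒0<q-p : ∀ {p q} → p < q → 0ℚ < q - p
p<q⇒0<q-p {p} {q} p<q = subst (_< q - p) (+-inverseʳ p) (+-monoˡ-< (- p) p<q)

/'-pos : ∀ p q .{{_ : Positive q}} → p /' q ≡ (p ÷ q) {{pos⇒nonZero q}}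
/'-pos p q with q ≟ 0ℚ
... | yes q≡0 = ⊥-elim (<⇒≢ (positive⁻¹ q) (sym q≡0))
... | no _    = refl

module _ (a c : ℚ) .{{_ : Positive a}} .{{_ : NonNegative c}} where

  private instance
    a≢0 : NonZero a
    a≢0 = pos⇒nonZero a
    c÷a≥0 : NonNegative (c ÷ a)
    c÷a≥0 = nonNeg*nonNeg⇒nonNeg c (1/ a) {{pos⇒nonNeg (1/ a) {{1/pos⇒pos a}}}}

  /'-≤-scaled : ∀ {p q r s} .{{_ : Positive s}} → 0ℚ ≤ q → p ≤ c * q → a * s ≤ r →
                p /' r ≤ (c ÷ a) * (q /' s)
  /'-≤-scaled {p} {q} {r} {s} q≥0 p≤cq as≤r = begin
    p /' r           ≡⟨ /'-pos p r ⟩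
    p ÷ r            ≤⟨ *-cancelʳ-≤-pos r cross-multiplied ⟩
    c ÷ a * (q ÷ s)  ≡⟨ cong (c ÷ a *_) (sym (/'-pos q s)) ⟩
    c ÷ a * (q /' s) ∎
    where
    open ≤-Reasoning
    open +-*-Solver
    instance
      s≢0 : NonZero s
      s≢0 = pos⇒nonZero s
      r>0 : Positive r
      r>0 = positive (<-≤-trans (positive⁻¹ (a * s) {{pos*pos⇒pos a s}}) as≤r)
      r≢0 : NonZero r
      r≢0 = pos⇒nonZero r
      q÷s≥0 : NonNegative (q ÷ s)
      q÷s≥0 = nonNeg*nonNeg⇒nonNeg q {{nonNegative q≥0}} (1/ s) {{pos⇒nonNeg (1/ s) {{1/pos⇒pos s}}}}
      c÷a*q÷s≥0 : NonNegative (c ÷ a * (q ÷ s))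
      c÷a*q÷s≥0 = nonNeg*nonNeg⇒nonNeg (c ÷ a) (q ÷ s)
    cross-multiplied : p ÷ r * r ≤ c ÷ a * (q ÷ s) * r
    cross-multiplied = begin
      p * 1/ r * r               ≡⟨ *-assoc p (1/ r) r ⟩
      p * (1/ r * r)             ≡⟨ cong (p *_) (*-inverseˡ r) ⟩
      p * 1ℚ                     ≡⟨ *-identityʳ p ⟩
      p                          ≤⟨ p≤cq ⟩
      c * q                      ≡⟨ sym (*-identityʳ (c * q)) ⟩
      c * q * (1ℚ * 1ℚ)          ≡⟨ sym (cong₂ (λ u v → c * q * (u * v)) (*-inverseˡ a) (*-inverseˡ s)) ⟩
      c * q * (1/ a * a * (1/ s * s))
        ≡⟨ solve 6 (λ c q a a⁻¹ s s⁻¹ → c :* q :* (a⁻¹ :* a :* (s⁻¹ :* s)) := c :* a⁻¹ :* (q :* s⁻¹) :* (a :* s)) refl c q a (1/ a) s (1/ s) ⟩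
      c ÷ a * (q ÷ s) * (a * s)  ≤⟨ *-monoˡ-≤-nonNeg (c ÷ a * (q ÷ s)) as≤r ⟩
      c ÷ a * (q ÷ s) * r        ∎

  module _ {n} {P Q : Fin n → ℚ} (Q≥0 : ∀ t → 0ℚ ≤ Q t)
           (aQ≤P : ∀ t → a * Q t ≤ P t) (P≤cQ : ∀ t → P t ≤ c * Q t)
           {x : Fin n} (Qx>0 : 0ℚ < Q x) where

    private
      /'-mass-≤-scaled : ∀ {y lo hi} → lo ℕ.≤ toℕ x → toℕ x ℕ.≤ hi →
                         P y /' mass P lo hi ≤ (c ÷ a) * (Q y /' mass Q lo hi)
      /'-mass-≤-scaled {y} {lo} {hi} lo≤x x≤hi =
        /'-≤-scaled {{positive (mass-pos Q≥0 Qx>0 lo≤x x≤hi)}} (Q≥0 y) (P≤cQ y) (*-mass-≤ a aQ≤P lo hi)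

    tiltTerm-≤-scaled : ∀ y → tiltTerm P x y ≤ (c ÷ a) * tiltTerm Q x y
    tiltTerm-≤-scaled y with toℕ y ℕ.<? toℕ x
    ... | yes y<x = /'-mass-≤-scaled y<x ℕ.≤-refl
    ... | no _ with toℕ x ℕ.<? toℕ y
    ...   | yes x<y = /'-mass-≤-scaled ℕ.≤-refl (ℕ.∸-monoˡ-≤ 1 x<y)
    ...   | no _    = ≤-reflexive (sym (*-zeroʳ (c ÷ a)))

    tilt-≤-scaled : tilt P x ≤ (c ÷ a) * tilt Q x
    tilt-≤-scaled = max-≤-*max (c ÷ a) tiltTerm-≤-scaled (allFin n)

claim14 : (ε₁ : ℚ) → 0ℚ < ε₁ → ε₁ < 1ℚ →
    ∃[ C ] ((n : ℕ) (P Q : Fin n → ℚ) → IsDistribution P → IsDistribution Q →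
      (∀ x → ((1ℚ - ε₁) * Q x ≤ P x) × (P x ≤ (1ℚ + ε₁) * Q x)) →
      (x : Fin n) → 0ℚ < P x → 0ℚ < Q x →
      tilt P x ≤ C * tilt Q x)
claim14 ε ε>0 ε<1 =
  (1ℚ + ε) ÷ (1ℚ - ε) ,
  λ n P Q _ (Q≥0 , _) bounds x _ Qx>0 →
    tilt-≤-scaled (1ℚ - ε) (1ℚ + ε) Q≥0 (proj₁ ∘ bounds) (proj₂ ∘ bounds) Qx>0
  where
  instance
    1-ε>0 : Positive (1ℚ - ε)
    1-ε>0 = positive (p<q⇒0<q-p ε<1)
    1-ε≢0 : NonZero (1ℚ - ε)
    1-ε≢0 = pos⇒nonZero (1ℚ - ε)
    1+ε≥0 : NonNegative (1ℚ + ε)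
    1+ε≥0 = nonNegative (+-mono-≤ (nonNegative⁻¹ 1ℚ) (<⇒≤ ε>0))
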